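{- For all integers $k\ge2$ and $n\ge0$, \[ \sum_{\ell=1}^{k}(-1)^{\ell}(n+\ell)!\,L(k,\ell) = \begin{cases} 0, & 0\le n\le k-2,\\[4pt] (-1)^k\dfrac{n!\,(n+1)!}{(n-k+1)!}, & n\ge k-1, \end{cases} \] where $L(k,\ell)$ denotes the Lah number.
   Context: The Lah numbers are defined for integers $1\le \ell\le k$ by $L(k,\ell)=\binom{k-1}{\ell-1}\frac{k!}{\ell!}$; equivalently, $L(k,\ell)$ is the number of ways to partition a $k$-element set into $\ell$ nonempty linearly ordered subsets. -}

module Defs where

open import Data.Nat using (ℕ; zero; suc; _*_; _∸_; _!; _/_)
open import Data.Nat.Properties using (_!≢0)
open import Data.Nat.Combinatorics using (_C_)
open import Data.Integer using (ℤ; +_; -_) renaming (_+_ to _+ℤ_; _*_ to _*ℤ_)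

-- Lah number L(k,ℓ) = C(k-1,ℓ-1) · k!/ℓ!  (k!/ℓ! is exact for 1 ≤ ℓ ≤ k;
-- only used in that range).
Lah : ℕ → ℕ → ℕ
Lah k ℓ = ((k ∸ 1) C (ℓ ∸ 1)) * ((k !) / (ℓ !)) where instance _ = ℓ !≢0

sgn : ℕ → ℤ
sgn zero = + 1
sgn (suc ℓ) = - sgn ℓ

sum1 : ℕ → (ℕ → ℤ) → ℤ
sum1 zero f = + 0
sum1 (suc m) f = sum1 m f +ℤ f (suc m)

lahSum : ℕ → ℕ → ℤ
lahSum k n = sum1 k (λ ℓ → sgn ℓ *ℤ + (((n Data.Nat.+ ℓ) !) * Lah k ℓ))

-- n! (n+1)! / (n-k+1)!   (exact when n ≥ k-1)
rhsMag : ℕ → ℕ → ℕ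
rhsMag k n = ((n !) * ((suc n) !)) / ((suc n ∸ k) !) where instance _ = (suc n ∸ k) !≢0

module Submission where

-- Lah numbers are the connection coefficients from falling to rising
-- factorials: for every integer x and every k,
--     Σ_{ℓ} L(k,ℓ) · x(x-1)⋯(x-ℓ+1)  =  x(x+1)⋯(x+k-1).
-- At x = -(n+1) the falling factorial is (-1)^ℓ (n+ℓ)!/n!, so the paper's sum equals
-- n! · (-(n+1))(-n)⋯(k-n-2).  This product contains the factor 0 as soon as k ≥ n+2,
-- and otherwise equals (-1)^k (n+1)!/(n+1-k)!, which gives both cases of the theorem.

open import Data.Nat using (ℕ; zero; suc; _≤_; _<_; z≤n; s≤s; _!; _∸_)
open import Data.Nat.Combinatorics using (_C_)
open import Relation.Binary.PropositionalEquality
  using (_≡_; refl; sym; trans; cong; cong₂; subst; module ≡-Reasoning)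
open import Defs

module LahTriangle where

  open import Data.Nat using (_+_; _*_; _/_)
  open import Data.Nat.Properties
    using (*-zeroʳ; *-assoc; *-identityˡ; *-identityʳ; +-identityʳ; m<n⇒m<1+n; _≤?_; ≰⇒>; *-cancelʳ-≡; _!≢0)
  open import Data.Nat.Combinatorics
    using (k>n⇒nCk≡0; nCk+nC[k+1]≡[n+1]C[k+1]; nC1≡n; k![n∸k]!∣n!)
  open import Data.Nat.Divisibility using (∣-trans; m∣m*n)
  open import Data.Nat.DivMod using (m/n*n≡m)
  open import Relation.Nullary using (yes; no)
  import Data.Nat.Tactic.RingSolver as Ring
  open ≡-Reasoning

  -- Unsigned Lah numbers L(k,ℓ) by the triangular recurrence: the element k+1 either
  -- forms a new list or is inserted into one of the k+ℓ+1 gaps of ℓ+1 lists.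
  lah : ℕ → ℕ → ℕ
  lah zero    zero    = 1
  lah zero    (suc ℓ) = 0
  lah (suc k) zero    = 0
  lah (suc k) (suc ℓ) = (k + suc ℓ) * lah k (suc ℓ) + lah k ℓ

  lahBelow : ℕ → ℕ → ℕ
  lahBelow k zero    = 0
  lahBelow k (suc ℓ) = lah k ℓ

  lah-rec : ∀ k ℓ → lah (suc k) ℓ ≡ (k + ℓ) * lah k ℓ + lahBelow k ℓ
  lah-rec zero    zero    = refl
  lah-rec (suc k) zero    = sym (cong (_+ 0) (*-zeroʳ (suc k + 0)))
  lah-rec k       (suc ℓ) = refl

  lah-vanish : ∀ {k ℓ} → k < ℓ → lah k ℓ ≡ 0
  lah-vanish {zero}  {suc ℓ} _       = refl
  lah-vanish {suc k} {suc ℓ} (s≤s p) = begin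
      (k + suc ℓ) * lah k (suc ℓ) + lah k ℓ
    ≡⟨ cong₂ (λ a b → (k + suc ℓ) * a + b) (lah-vanish (m<n⇒m<1+n p)) (lah-vanish p) ⟩
      (k + suc ℓ) * 0 + 0
    ≡⟨ cong (_+ 0) (*-zeroʳ (k + suc ℓ)) ⟩
      0 ∎

  absorption : ∀ m ℓ → suc ℓ * (m C suc ℓ) + ℓ * (m C ℓ) ≡ m * (m C ℓ)
  absorption zero    zero    = refl
  absorption zero    (suc ℓ) = cong₂ _+_ (*-zeroʳ (suc (suc ℓ))) (*-zeroʳ (suc ℓ))
  absorption (suc m) zero    = begin
      1 * (suc m C 1) + 0 ≡⟨ +-identityʳ _ ⟩
      1 * (suc m C 1)     ≡⟨ *-identityˡ _ ⟩
      suc m C 1           ≡⟨ nC1≡n (suc m) ⟩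
      suc m               ≡⟨ sym (*-identityʳ (suc m)) ⟩
      suc m * 1           ∎
  absorption (suc m) (suc ℓ) = begin
      suc (suc ℓ) * (suc m C suc (suc ℓ)) + suc ℓ * (suc m C suc ℓ)
    ≡⟨ cong₂ (λ a b → suc (suc ℓ) * a + suc ℓ * b) (sym (pascal (suc ℓ))) (sym (pascal ℓ)) ⟩
      suc (suc ℓ) * (c₁ + c₂) + suc ℓ * (c₀ + c₁)
    ≡⟨ regroup m ℓ c₀ c₁ c₂ ⟩
      (suc (suc ℓ) * c₂ + suc ℓ * c₁) + (suc ℓ * c₁ + ℓ * c₀) + c₁ + c₀
    ≡⟨ cong₂ (λ a b → a + b + c₁ + c₀) (absorption m (suc ℓ)) (absorption m ℓ) ⟩
      m * c₁ + m * c₀ + c₁ + c₀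
    ≡⟨ collect m c₀ c₁ ⟩
      suc m * (c₀ + c₁)
    ≡⟨ cong (suc m *_) (pascal ℓ) ⟩
      suc m * (suc m C suc ℓ) ∎
    where
      pascal : ∀ j → m C j + m C suc j ≡ suc m C suc j
      pascal = nCk+nC[k+1]≡[n+1]C[k+1] m
      c₀ c₁ c₂ : ℕ
      c₀ = m C ℓ
      c₁ = m C suc ℓ
      c₂ = m C suc (suc ℓ)
      regroup : ∀ m ℓ c₀ c₁ c₂ → suc (suc ℓ) * (c₁ + c₂) + suc ℓ * (c₀ + c₁)
              ≡ (suc (suc ℓ) * c₂ + suc ℓ * c₁) + (suc ℓ * c₁ + ℓ * c₀) + c₁ + c₀
      regroup = Ring.solve-∀
      collect : ∀ m c₀ c₁ → m * c₁ + m * c₀ + c₁ + c₀ ≡ suc m * (c₀ + c₁)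
      collect = Ring.solve-∀

  lah-factorial : ∀ m ℓ → lah (suc m) (suc ℓ) * (suc ℓ) ! ≡ (m C ℓ) * (suc m) !
  lah-factorial zero    zero    = refl
  lah-factorial zero    (suc ℓ) = cong (_* (suc (suc ℓ)) !) (lah-vanish {1} {suc (suc ℓ)} (s≤s (s≤s z≤n)))
  lah-factorial (suc m) zero    = begin
      ((suc m + 1) * a + 0) * 1 ≡⟨ collect m a ⟩
      suc (suc m) * (a * 1)     ≡⟨ cong (suc (suc m) *_) (lah-factorial m zero) ⟩
      suc (suc m) * (1 * G)     ≡⟨ cong (suc (suc m) *_) (*-identityˡ G) ⟩
      suc (suc m) * G           ≡⟨ sym (*-identityˡ _) ⟩
      1 * (suc (suc m)) !       ∎
    where
      a G : ℕ
      a = lah (suc m) 1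
      G = (suc m) !
      collect : ∀ m a → ((suc m + 1) * a + 0) * 1 ≡ suc (suc m) * (a * 1)
      collect = Ring.solve-∀
  lah-factorial (suc m) (suc ℓ) = begin
      ((suc m + suc (suc ℓ)) * X + Y) * (suc (suc ℓ) * F)
    ≡⟨ expand m ℓ X Y F ⟩
      (suc m + suc (suc ℓ)) * (X * (suc (suc ℓ) * F)) + suc (suc ℓ) * (Y * F)
    ≡⟨ cong₂ (λ a b → (suc m + suc (suc ℓ)) * a + suc (suc ℓ) * b)
             (lah-factorial m (suc ℓ)) (lah-factorial m ℓ) ⟩
      (suc m + suc (suc ℓ)) * (c₁ * G) + suc (suc ℓ) * (c₀ * G)
    ≡⟨ regroup m ℓ c₀ c₁ G ⟩
      (suc (suc m) * c₁ + 2 * c₀ + (suc ℓ * c₁ + ℓ * c₀)) * G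
    ≡⟨ cong (λ a → (suc (suc m) * c₁ + 2 * c₀ + a) * G) (absorption m ℓ) ⟩
      (suc (suc m) * c₁ + 2 * c₀ + m * c₀) * G
    ≡⟨ collect m c₀ c₁ G ⟩
      (c₀ + c₁) * (suc (suc m) * G)
    ≡⟨ cong (_* (suc (suc m)) !) (nCk+nC[k+1]≡[n+1]C[k+1] m ℓ) ⟩
      (suc m C suc ℓ) * (suc (suc m)) ! ∎
    where
      X Y F G c₀ c₁ : ℕ
      X = lah (suc m) (suc (suc ℓ))
      Y = lah (suc m) (suc ℓ)
      F = (suc ℓ) !
      G = (suc m) !
      c₀ = m C ℓ
      c₁ = m C suc ℓ
      expand : ∀ m ℓ X Y F → ((suc m + suc (suc ℓ)) * X + Y) * (suc (suc ℓ) * F)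
             ≡ (suc m + suc (suc ℓ)) * (X * (suc (suc ℓ) * F)) + suc (suc ℓ) * (Y * F)
      expand = Ring.solve-∀
      regroup : ∀ m ℓ c₀ c₁ G → (suc m + suc (suc ℓ)) * (c₁ * G) + suc (suc ℓ) * (c₀ * G)
              ≡ (suc (suc m) * c₁ + 2 * c₀ + (suc ℓ * c₁ + ℓ * c₀)) * G
      regroup = Ring.solve-∀
      collect : ∀ m c₀ c₁ G → (suc (suc m) * c₁ + 2 * c₀ + m * c₀) * G ≡ (c₀ + c₁) * (suc (suc m) * G)
      collect = Ring.solve-∀

  Lah≡lah : ∀ m ℓ → Lah (suc m) (suc ℓ) ≡ lah (suc m) (suc ℓ)
  Lah≡lah m ℓ with ℓ ≤? m
  ... | yes ℓ≤m = *-cancelʳ-≡ _ _ ((suc ℓ) !) (begin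
        (m C ℓ) * ((suc m) ! / (suc ℓ) !) * (suc ℓ) !
      ≡⟨ *-assoc (m C ℓ) _ _ ⟩
        (m C ℓ) * ((suc m) ! / (suc ℓ) ! * (suc ℓ) !)
      ≡⟨ cong ((m C ℓ) *_) (m/n*n≡m (∣-trans (m∣m*n _) (k![n∸k]!∣n! (s≤s ℓ≤m)))) ⟩
        (m C ℓ) * (suc m) !
      ≡⟨ sym (lah-factorial m ℓ) ⟩
        lah (suc m) (suc ℓ) * (suc ℓ) ! ∎)
    where instance _ = suc ℓ !≢0
  ... | no ℓ≰m = begin
        (m C ℓ) * ((suc m) ! / (suc ℓ) !) ≡⟨ cong (_* ((suc m) ! / (suc ℓ) !)) (k>n⇒nCk≡0 ℓ>m) ⟩
        0                                   ≡⟨ sym (lah-vanish (s≤s ℓ>m)) ⟩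
        lah (suc m) (suc ℓ)                 ∎
    where
      instance _ = suc ℓ !≢0
      ℓ>m : m < ℓ
      ℓ>m = ≰⇒> ℓ≰m

open LahTriangle

module Permutations where

  open import Data.Nat using (_*_; _/_)
  open import Data.Nat.Properties using (*-identityˡ; *-assoc; *-comm; <⇒≤; _!≢0)
  open import Data.Nat.Combinatorics using ([n-k]*[n-k-1]!≡[n-k]!)
  open import Data.Nat.Combinatorics.Base using (_P′_) public
  open import Data.Nat.DivMod using (m*n/n≡m)
  open ≡-Reasoning

  P′-factorial : ∀ {m k} → k ≤ m → (m P′ k) * (m ∸ k) ! ≡ m !
  P′-factorial {m} {zero}  _   = *-identityˡ (m !)
  P′-factorial {m} {suc k} k<m = begin
      (m ∸ k) * (m P′ k) * (m ∸ suc k) !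
    ≡⟨ cong (_* (m ∸ suc k) !) (*-comm (m ∸ k) (m P′ k)) ⟩
      (m P′ k) * (m ∸ k) * (m ∸ suc k) !
    ≡⟨ *-assoc (m P′ k) (m ∸ k) ((m ∸ suc k) !) ⟩
      (m P′ k) * ((m ∸ k) * (m ∸ suc k) !)
    ≡⟨ cong ((m P′ k) *_) ([n-k]*[n-k-1]!≡[n-k]! k<m) ⟩
      (m P′ k) * (m ∸ k) !
    ≡⟨ P′-factorial (<⇒≤ k<m) ⟩
      m ! ∎

  rhsMag≡ : ∀ {n k} → k ≤ suc n → rhsMag k n ≡ n ! * (suc n P′ k)
  rhsMag≡ {n} {k} k≤1+n = begin
      (n ! * (suc n) !) / D          ≡⟨ cong (λ a → (n ! * a) / D) (sym (P′-factorial k≤1+n)) ⟩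
      (n ! * ((suc n P′ k) * D)) / D   ≡⟨ cong (_/ D) (sym (*-assoc (n !) (suc n P′ k) D)) ⟩
      (n ! * (suc n P′ k) * D) / D   ≡⟨ m*n/n≡m (n ! * (suc n P′ k)) D ⟩
      n ! * (suc n P′ k)             ∎
    where
      D : ℕ
      D = (suc n ∸ k) !
      instance _ = (suc n ∸ k) !≢0

open Permutations

module FiniteSums where

  open import Data.Integer using (ℤ; +_; _+_; _*_)
  open import Data.Integer.Properties using (+-identityˡ; +-identityʳ; +-assoc; *-zeroʳ; *-distribˡ-+)
  import Data.Integer.Tactic.RingSolver as Ring

  Σ< : ℕ → (ℕ → ℤ) → ℤ
  Σ< zero    f = + 0
  Σ< (suc M) f = Σ< M f + f M

  Σ<-cong : ∀ M {f g : ℕ → ℤ} → (∀ ℓ → f ℓ ≡ g ℓ) → Σ< M f ≡ Σ< M g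
  Σ<-cong zero    f≡g = refl
  Σ<-cong (suc M) f≡g = cong₂ _+_ (Σ<-cong M f≡g) (f≡g M)

  Σ<-peel : ∀ M (f : ℕ → ℤ) → Σ< (suc M) f ≡ f 0 + Σ< M (λ ℓ → f (suc ℓ))
  Σ<-peel zero    f = trans (+-identityˡ (f 0)) (sym (+-identityʳ (f 0)))
  Σ<-peel (suc M) f = trans (cong (_+ f (suc M)) (Σ<-peel M f)) (+-assoc (f 0) _ _)

  Σ<-+ : ∀ M (f g : ℕ → ℤ) → Σ< M (λ ℓ → f ℓ + g ℓ) ≡ Σ< M f + Σ< M g
  Σ<-+ zero    f g = refl
  Σ<-+ (suc M) f g = trans (cong (_+ (f M + g M)) (Σ<-+ M f g)) (interchange (Σ< M f) (Σ< M g) (f M) (g M))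
    where
      interchange : ∀ a b c d → (a + b) + (c + d) ≡ (a + c) + (b + d)
      interchange = Ring.solve-∀

  Σ<-scale : ∀ M c (f : ℕ → ℤ) → Σ< M (λ ℓ → c * f ℓ) ≡ c * Σ< M f
  Σ<-scale zero    c f = sym (*-zeroʳ c)
  Σ<-scale (suc M) c f = trans (cong (_+ c * f M) (Σ<-scale M c f)) (sym (*-distribˡ-+ c _ _))

  sum1≡Σ< : ∀ k (f : ℕ → ℤ) → sum1 k f ≡ Σ< k (λ ℓ → f (suc ℓ))
  sum1≡Σ< zero    f = refl
  sum1≡Σ< (suc k) f = cong (_+ f (suc k)) (sum1≡Σ< k f)

open FiniteSums

module Factorials where

  import Data.Nat as ℕ
  import Data.Nat.Properties as ℕₚ
  open import Data.Integer using (ℤ; +_; -_; -[1+_]; _+_; _-_; _*_)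
  open import Data.Integer.Properties
    using (+-identityˡ; +-identityʳ; *-identityˡ; *-identityʳ; *-zeroˡ; *-zeroʳ; *-assoc; *-comm;
           pos-+; pos-*; neg-distrib-+; +-inverseˡ; -m+n≡n⊖m; ⊖-≤)
  open import Data.Sum using (inj₁; inj₂)
  import Data.Integer.Tactic.RingSolver as Ring
  open ≡-Reasoning

  rising : ℤ → ℕ → ℤ
  rising x zero    = + 1
  rising x (suc k) = rising x k * (x + + k)

  falling : ℤ → ℕ → ℤ
  falling x zero    = + 1
  falling x (suc k) = falling x k * (x - + k)

  lah-rec-ℤ : ∀ k ℓ f → + lah (suc k) ℓ * f ≡ + (k ℕ.+ ℓ) * (+ lah k ℓ * f) + + lahBelow k ℓ * f
  lah-rec-ℤ k ℓ f = begin
      + lah (suc k) ℓ * f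
    ≡⟨ cong (λ a → + a * f) (lah-rec k ℓ) ⟩
      + ((k ℕ.+ ℓ) ℕ.* lah k ℓ ℕ.+ lahBelow k ℓ) * f
    ≡⟨ cong (_* f) (trans (pos-+ ((k ℕ.+ ℓ) ℕ.* lah k ℓ) (lahBelow k ℓ)) (cong (_+ + lahBelow k ℓ) (pos-* (k ℕ.+ ℓ) (lah k ℓ)))) ⟩
      (+ (k ℕ.+ ℓ) * + lah k ℓ + + lahBelow k ℓ) * f
    ≡⟨ distribute (+ (k ℕ.+ ℓ)) (+ lah k ℓ) (+ lahBelow k ℓ) f ⟩
      + (k ℕ.+ ℓ) * (+ lah k ℓ * f) + + lahBelow k ℓ * f ∎
    where
      distribute : ∀ a b c f → (a * b + c) * f ≡ a * (b * f) + c * f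
      distribute = Ring.solve-∀

  -- The "new list" part of the recurrence: since falling x (j+1) = falling x j · (x - j),
  -- Σ_ℓ L(k,ℓ-1)·falling x ℓ = Σ_ℓ (x-ℓ)·L(k,ℓ)·falling x ℓ, once the sums pass ℓ = k.
  lahBelow-sum : ∀ x k M → k < M →
    Σ< (suc M) (λ ℓ → + lahBelow k ℓ * falling x ℓ) ≡ Σ< (suc M) (λ ℓ → (x - + ℓ) * (+ lah k ℓ * falling x ℓ))
  lahBelow-sum x k M k<M = begin
      Σ< (suc M) (λ ℓ → + lahBelow k ℓ * falling x ℓ)
    ≡⟨ Σ<-peel M (λ ℓ → + lahBelow k ℓ * falling x ℓ) ⟩
      + 0 + Σ< M (λ j → + lah k j * (falling x j * (x - + j)))
    ≡⟨ +-identityˡ (Σ< M (λ j → + lah k j * (falling x j * (x - + j)))) ⟩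
      Σ< M (λ j → + lah k j * (falling x j * (x - + j)))
    ≡⟨ Σ<-cong M (λ j → rotate (+ lah k j) (falling x j) (x - + j)) ⟩
      S
    ≡⟨ sym (+-identityʳ S) ⟩
      S + + 0
    ≡⟨ cong (_+_ S) (sym lastTerm) ⟩
      Σ< (suc M) (λ ℓ → (x - + ℓ) * (+ lah k ℓ * falling x ℓ)) ∎
    where
      S : ℤ
      S = Σ< M (λ j → (x - + j) * (+ lah k j * falling x j))
      rotate : ∀ a b c → a * (b * c) ≡ c * (a * b)
      rotate = Ring.solve-∀
      lastTerm : (x - + M) * (+ lah k M * falling x M) ≡ + 0
      lastTerm = trans (cong (λ a → (x - + M) * (+ a * falling x M)) (lah-vanish k<M)) (*-zeroʳ (x - + M))

  lah-falling-rising : ∀ x k M → k < M → Σ< M (λ ℓ → + lah k ℓ * falling x ℓ) ≡ rising x k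
  lah-falling-rising x zero (suc M) _ = begin
      Σ< (suc M) (λ ℓ → + lah 0 ℓ * falling x ℓ)
    ≡⟨ Σ<-peel M (λ ℓ → + lah 0 ℓ * falling x ℓ) ⟩
      + 1 + Σ< M (λ j → + 0 * falling x (suc j))
    ≡⟨ cong (_+_ (+ 1)) (Σ<-scale M (+ 0) (λ j → falling x (suc j))) ⟩
      + 1 + + 0 * Σ< M (λ j → falling x (suc j))
    ≡⟨ cong (_+_ (+ 1)) (*-zeroˡ (Σ< M (λ j → falling x (suc j)))) ⟩
      + 1 ∎
  lah-falling-rising x (suc k) (suc M) (s≤s k<M) = begin
      Σ< (suc M) (λ ℓ → + lah (suc k) ℓ * falling x ℓ)
    ≡⟨ Σ<-cong (suc M) (λ ℓ → lah-rec-ℤ k ℓ (falling x ℓ)) ⟩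
      Σ< (suc M) (λ ℓ → + (k ℕ.+ ℓ) * T ℓ + + lahBelow k ℓ * falling x ℓ)
    ≡⟨ Σ<-+ (suc M) (λ ℓ → + (k ℕ.+ ℓ) * T ℓ) (λ ℓ → + lahBelow k ℓ * falling x ℓ) ⟩
      Σ< (suc M) (λ ℓ → + (k ℕ.+ ℓ) * T ℓ) + Σ< (suc M) (λ ℓ → + lahBelow k ℓ * falling x ℓ)
    ≡⟨ cong (_+_ (Σ< (suc M) (λ ℓ → + (k ℕ.+ ℓ) * T ℓ))) (lahBelow-sum x k M k<M) ⟩
      Σ< (suc M) (λ ℓ → + (k ℕ.+ ℓ) * T ℓ) + Σ< (suc M) (λ ℓ → (x - + ℓ) * T ℓ)
    ≡⟨ sym (Σ<-+ (suc M) (λ ℓ → + (k ℕ.+ ℓ) * T ℓ) (λ ℓ → (x - + ℓ) * T ℓ)) ⟩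
      Σ< (suc M) (λ ℓ → + (k ℕ.+ ℓ) * T ℓ + (x - + ℓ) * T ℓ)
    ≡⟨ Σ<-cong (suc M) combine ⟩
      Σ< (suc M) (λ ℓ → (x + + k) * T ℓ)
    ≡⟨ Σ<-scale (suc M) (x + + k) T ⟩
      (x + + k) * Σ< (suc M) T
    ≡⟨ cong ((x + + k) *_) (lah-falling-rising x k (suc M) (ℕₚ.m≤n⇒m≤1+n k<M)) ⟩
      (x + + k) * rising x k
    ≡⟨ *-comm (x + + k) (rising x k) ⟩
      rising x (suc k) ∎
    where
      T : ℕ → ℤ
      T ℓ = + lah k ℓ * falling x ℓ
      combine : ∀ ℓ → + (k ℕ.+ ℓ) * T ℓ + (x - + ℓ) * T ℓ ≡ (x + + k) * T ℓ
      combine ℓ = trans (cong (λ a → a * T ℓ + (x - + ℓ) * T ℓ) (pos-+ k ℓ)) (collect (+ k) (+ ℓ) x (T ℓ))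
        where
          collect : ∀ K L x t → (K + L) * t + (x - L) * t ≡ (x + K) * t
          collect = Ring.solve-∀

  sign-flip : ∀ s a b → s * a * (- b) ≡ (- s) * (b * a)
  sign-flip = Ring.solve-∀

  falling-at-neg : ∀ n ℓ → + (n !) * falling -[1+ n ] ℓ ≡ sgn ℓ * + ((n ℕ.+ ℓ) !)
  falling-at-neg n zero = begin
      + (n !) * + 1          ≡⟨ *-identityʳ (+ (n !)) ⟩
      + (n !)                ≡⟨ cong (λ m → + (m !)) (sym (ℕₚ.+-identityʳ n)) ⟩
      + ((n ℕ.+ 0) !)        ≡⟨ sym (*-identityˡ (+ ((n ℕ.+ 0) !))) ⟩
      + 1 * + ((n ℕ.+ 0) !)  ∎
  falling-at-neg n (suc ℓ) = begin
      + (n !) * (falling -[1+ n ] ℓ * (-[1+ n ] - + ℓ))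
    ≡⟨ sym (*-assoc (+ (n !)) (falling -[1+ n ] ℓ) (-[1+ n ] - + ℓ)) ⟩
      + (n !) * falling -[1+ n ] ℓ * (-[1+ n ] - + ℓ)
    ≡⟨ cong₂ _*_ (falling-at-neg n ℓ) factor ⟩
      sgn ℓ * + ((n ℕ.+ ℓ) !) * (- + suc (n ℕ.+ ℓ))
    ≡⟨ sign-flip (sgn ℓ) (+ ((n ℕ.+ ℓ) !)) (+ suc (n ℕ.+ ℓ)) ⟩
      sgn (suc ℓ) * (+ suc (n ℕ.+ ℓ) * + ((n ℕ.+ ℓ) !))
    ≡⟨ cong (sgn (suc ℓ) *_) (sym (pos-* (suc (n ℕ.+ ℓ)) ((n ℕ.+ ℓ) !))) ⟩
      sgn (suc ℓ) * + (suc (n ℕ.+ ℓ) !)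
    ≡⟨ cong (λ m → sgn (suc ℓ) * + (m !)) (sym (ℕₚ.+-suc n ℓ)) ⟩
      sgn (suc ℓ) * + ((n ℕ.+ suc ℓ) !) ∎
    where
      factor : -[1+ n ] - + ℓ ≡ - + suc (n ℕ.+ ℓ)
      factor = trans (sym (neg-distrib-+ (+ suc n) (+ ℓ))) (cong -_ (sym (pos-+ (suc n) ℓ)))

  rising-at-neg-vanish : ∀ n k → suc (suc n) ≤ k → rising -[1+ n ] k ≡ + 0
  rising-at-neg-vanish n (suc k) (s≤s n+1≤k) with ℕₚ.m≤n⇒m<n∨m≡n n+1≤k
  ... | inj₁ n+1<k = trans (cong (_* (-[1+ n ] + + k)) (rising-at-neg-vanish n k n+1<k))
                           (*-zeroˡ (-[1+ n ] + + k))
  ... | inj₂ refl  = trans (cong (rising -[1+ n ] (suc n) *_) (+-inverseˡ (+ suc n)))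
                           (*-zeroʳ (rising -[1+ n ] (suc n)))

  rising-at-neg : ∀ n k → k ≤ suc n → rising -[1+ n ] k ≡ sgn k * + (suc n P′ k)
  rising-at-neg n zero    _     = refl
  rising-at-neg n (suc k) k<1+n = begin
      rising -[1+ n ] k * (-[1+ n ] + + k)
    ≡⟨ cong₂ _*_ (rising-at-neg n k (ℕₚ.<⇒≤ k<1+n)) factor ⟩
      sgn k * + (suc n P′ k) * (- + (suc n ∸ k))
    ≡⟨ sign-flip (sgn k) (+ (suc n P′ k)) (+ (suc n ∸ k)) ⟩
      sgn (suc k) * (+ (suc n ∸ k) * + (suc n P′ k))
    ≡⟨ cong (sgn (suc k) *_) (sym (pos-* (suc n ∸ k) (suc n P′ k))) ⟩
      sgn (suc k) * + (suc n P′ suc k) ∎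
    where
      factor : -[1+ n ] + + k ≡ - + (suc n ∸ k)
      factor = trans (-m+n≡n⊖m (suc n) k) (⊖-≤ (ℕₚ.<⇒≤ k<1+n))

  summand-as-falling : ∀ n ℓ a → sgn ℓ * + ((n ℕ.+ ℓ) ! ℕ.* a) ≡ + (n !) * (+ a * falling -[1+ n ] ℓ)
  summand-as-falling n ℓ a = begin
      sgn ℓ * + ((n ℕ.+ ℓ) ! ℕ.* a)
    ≡⟨ cong (sgn ℓ *_) (pos-* ((n ℕ.+ ℓ) !) a) ⟩
      sgn ℓ * (+ ((n ℕ.+ ℓ) !) * + a)
    ≡⟨ swap (sgn ℓ) (+ ((n ℕ.+ ℓ) !)) (+ a) ⟩
      + a * (sgn ℓ * + ((n ℕ.+ ℓ) !))
    ≡⟨ cong (+ a *_) (sym (falling-at-neg n ℓ)) ⟩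
      + a * (+ (n !) * falling -[1+ n ] ℓ)
    ≡⟨ exchange (+ a) (+ (n !)) (falling -[1+ n ] ℓ) ⟩
      + (n !) * (+ a * falling -[1+ n ] ℓ) ∎
    where
      swap : ∀ a b c → a * (b * c) ≡ c * (a * b)
      swap = Ring.solve-∀
      exchange : ∀ a b c → a * (b * c) ≡ b * (a * c)
      exchange = Ring.solve-∀

  lahSum-as-rising : ∀ m n → lahSum (suc m) n ≡ + (n !) * rising -[1+ n ] (suc m)
  lahSum-as-rising m n = begin
      lahSum (suc m) n
    ≡⟨ sum1≡Σ< (suc m) (λ ℓ → sgn ℓ * + ((n ℕ.+ ℓ) ! ℕ.* Lah (suc m) ℓ)) ⟩
      Σ< (suc m) (λ j → sgn (suc j) * + ((n ℕ.+ suc j) ! ℕ.* Lah (suc m) (suc j)))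
    ≡⟨ Σ<-cong (suc m) (λ j → cong (λ a → sgn (suc j) * + ((n ℕ.+ suc j) ! ℕ.* a)) (Lah≡lah m j)) ⟩
      Σ< (suc m) (λ j → t (suc j))
    ≡⟨ sym (+-identityˡ (Σ< (suc m) (λ j → t (suc j)))) ⟩
      + 0 + Σ< (suc m) (λ j → t (suc j))
    ≡⟨ cong (_+ Σ< (suc m) (λ j → t (suc j))) (sym t₀≡0) ⟩
      t 0 + Σ< (suc m) (λ j → t (suc j))
    ≡⟨ sym (Σ<-peel (suc m) t) ⟩
      Σ< (suc (suc m)) t
    ≡⟨ Σ<-cong (suc (suc m)) (λ ℓ → summand-as-falling n ℓ (lah (suc m) ℓ)) ⟩
      Σ< (suc (suc m)) (λ ℓ → + (n !) * (+ lah (suc m) ℓ * falling -[1+ n ] ℓ))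
    ≡⟨ Σ<-scale (suc (suc m)) (+ (n !)) (λ ℓ → + lah (suc m) ℓ * falling -[1+ n ] ℓ) ⟩
      + (n !) * Σ< (suc (suc m)) (λ ℓ → + lah (suc m) ℓ * falling -[1+ n ] ℓ)
    ≡⟨ cong (_*_ (+ (n !))) (lah-falling-rising -[1+ n ] (suc m) (suc (suc m)) ℕₚ.≤-refl) ⟩
      + (n !) * rising -[1+ n ] (suc m) ∎
    where
      t : ℕ → ℤ
      t ℓ = sgn ℓ * + ((n ℕ.+ ℓ) ! ℕ.* lah (suc m) ℓ)
      t₀≡0 : t 0 ≡ + 0
      t₀≡0 = cong (λ a → + 1 * + a) (ℕₚ.*-zeroʳ ((n ℕ.+ 0) !))

open Factorials

open import Data.Nat using (_+_)
open import Data.Nat.Properties using (+-comm)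
import Data.Nat as ℕ
open import Data.Integer using (+_; -[1+_]; _*_)
open import Data.Integer.Properties using (*-zeroʳ; pos-*)
open import Data.Product using (_×_; _,_)
import Data.Integer.Tactic.RingSolver as Ring
open ≡-Reasoning

theorem1 : (k n : ℕ) → 2 ≤ k →
    ((n + 2 ≤ k → lahSum k n ≡ + 0) ×
     (k ≤ suc n → lahSum k n ≡ sgn k * + rhsMag k n))
-- Only k ≥ 1 is used: both cases hold already for k = 1.
theorem1 (suc m) n _ = vanishing , closedForm
  where
    vanishing : n + 2 ≤ suc m → lahSum (suc m) n ≡ + 0
    vanishing n+2≤k = begin
      lahSum (suc m) n                   ≡⟨ lahSum-as-rising m n ⟩
      + (n !) * rising -[1+ n ] (suc m)  ≡⟨ cong (_*_ (+ (n !))) (rising-at-neg-vanish n (suc m) n+2≤k′) ⟩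
      + (n !) * + 0                      ≡⟨ *-zeroʳ (+ (n !)) ⟩
      + 0                                ∎
      where
        n+2≤k′ : suc (suc n) ≤ suc m
        n+2≤k′ = subst (_≤ suc m) (+-comm n 2) n+2≤k
    closedForm : suc m ≤ suc n → lahSum (suc m) n ≡ sgn (suc m) * + rhsMag (suc m) n
    closedForm k≤n+1 = begin
      lahSum (suc m) n                                ≡⟨ lahSum-as-rising m n ⟩
      + (n !) * rising -[1+ n ] (suc m)               ≡⟨ cong (_*_ (+ (n !))) (rising-at-neg n (suc m) k≤n+1) ⟩
      + (n !) * (sgn (suc m) * + (suc n P′ suc m))    ≡⟨ exchange (+ (n !)) (sgn (suc m)) (+ (suc n P′ suc m)) ⟩
      sgn (suc m) * (+ (n !) * + (suc n P′ suc m))    ≡⟨ cong (_*_ (sgn (suc m))) (sym (pos-* (n !) (suc n P′ suc m))) ⟩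
      sgn (suc m) * + (n ! ℕ.* (suc n P′ suc m))     ≡⟨ cong (λ a → sgn (suc m) * + a) (sym (rhsMag≡ k≤n+1)) ⟩
      sgn (suc m) * + rhsMag (suc m) n                ∎
      where
        exchange : ∀ a b c → a * (b * c) ≡ b * (a * c)
        exchange = Ring.solve-∀
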